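{- Let $m\ge 3$ be odd. For the coloring $(f_0,f_1,f_2)$ of $D_3(m)$ defined below, each $f_c$ is a single directed cycle through all $m^3$ vertices; thus the three color classes decompose the arc set of $D_3(m)$ into three directed Hamilton cycles.
   Context: $V=(\mathbb Z_m)^3$ with points $v=(i,j,k)$; $D_3(m)$ has arcs $v\to v+e_1,v+e_2,v+e_3$ (mod $m$), $e_1,e_2,e_3$ the standard basis vectors; $S(v)=i+j+k\pmod m$; $\mathrm{bump}_i(i,j,k)=(i+1,j,k)$, $\mathrm{bump}_j(i,j,k)=(i,j+1,k)$, $\mathrm{bump}_k(i,j,k)=(i,j,k+1)$. The coloring is: $f_0(v)=\mathrm{bump}_j(v)$ if $S=0,k\ne0$; $\mathrm{bump}_k(v)$ if $S=1$; $\mathrm{bump}_i(v)$ otherwise. $f_1(v)=\mathrm{bump}_k(v)$ if $S=0$; $\mathrm{bump}_i(v)$ if $S=1,k=0$; $\mathrm{bump}_j(v)$ otherwise. $f_2(v)=\mathrm{bump}_j(v)$ if $S\in\{0,1\},k=0$; $\mathrm{bump}_i(v)$ if $S\in\{0,1\},k\ne0$; $\mathrm{bump}_k(v)$ otherwise. (It is a coloring: each $f_c$ is a permutation of $V$ and $\{f_0(v),f_1(v),f_2(v)\}=\{v+e_1,v+e_2,v+e_3\}$.) -}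

module Defs where

open import Data.Nat using (ℕ; zero; suc; _+_; _*_; _^_; _<_; NonZero)
open import Data.Nat.DivMod using (_%_; m%n<n)
open import Data.Fin using (Fin; toℕ; fromℕ<)
open import Data.Product using (_×_; _,_; ∃)
open import Relation.Binary.PropositionalEquality using (_≡_)
open import Function.Definitions using (Bijective)

incr : (m : ℕ) .{{_ : NonZero m}} → Fin m → Fin m
incr m x = fromℕ< (m%n<n (suc (toℕ x)) m)

V : ℕ → Set
V m = Fin m × Fin m × Fin m

bumpi bumpj bumpk : (m : ℕ) .{{_ : NonZero m}} → V m → V m
bumpi m (i , j , k) = (incr m i , j , k)
bumpj m (i , j , k) = (i , incr m j , k)
bumpk m (i , j , k) = (i , j , incr m k)

-- the three arc directions v ↦ v + e_1, v + e_2, v + e_3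
bump : (m : ℕ) .{{_ : NonZero m}} → Fin 3 → V m → V m
bump m Fin.zero = bumpi m
bump m (Fin.suc Fin.zero) = bumpj m
bump m (Fin.suc (Fin.suc Fin.zero)) = bumpk m

S : (m : ℕ) .{{_ : NonZero m}} → V m → ℕ
S m (i , j , k) = (toℕ i + toℕ j + toℕ k) % m

f0 : (m : ℕ) .{{_ : NonZero m}} → V m → V m
f0 m v@(i , j , k) with S m v | toℕ k
... | 0 | suc _ = bumpj m v
... | 0 | 0 = bumpi m v
... | 1 | _ = bumpk m v
... | suc (suc _) | _ = bumpi m v

f1 : (m : ℕ) .{{_ : NonZero m}} → V m → V m
f1 m v@(i , j , k) with S m v | toℕ k
... | 0 | _ = bumpk m v
... | 1 | 0 = bumpi m v
... | 1 | suc _ = bumpj m v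
... | suc (suc _) | _ = bumpj m v

f2 : (m : ℕ) .{{_ : NonZero m}} → V m → V m
f2 m v@(i , j , k) with S m v | toℕ k
... | 0 | 0 = bumpj m v
... | 0 | suc _ = bumpi m v
... | 1 | 0 = bumpj m v
... | 1 | suc _ = bumpi m v
... | suc (suc _) | _ = bumpk m v

f : (m : ℕ) .{{_ : NonZero m}} → Fin 3 → V m → V m
f m Fin.zero = f0 m
f m (Fin.suc Fin.zero) = f1 m
f m (Fin.suc (Fin.suc Fin.zero)) = f2 m

iterate : {A : Set} → (A → A) → ℕ → A → A
iterate g zero x = x
iterate g (suc n) x = g (iterate g n x)

-- g is a single directed cycle through all vertices:
-- g is a permutation and every vertex is reachable from every vertex.
IsHamiltonCycle : {A : Set} → (A → A) → Set
IsHamiltonCycle {A} g = Bijective _≡_ _≡_ g × (∀ (v w : A) → ∃ λ n → iterate g n v ≡ w)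

IsArcDecomposition : (m : ℕ) .{{_ : NonZero m}} → (Fin 3 → V m → V m) → Set
IsArcDecomposition m g =
  (∀ (c : Fin 3) (v : V m) → ∃ λ d → g c v ≡ bump m d v) ×
  (∀ (d : Fin 3) (v : V m) → ∃ λ c → g c v ≡ bump m d v × (∀ c' → g c' v ≡ bump m d v → c' ≡ c))

-- Every colour raises the level S by one, so f_c is a Hamilton cycle as soon as its
-- first-return map f_c^m to the level S = 0 is transitive there (f_c is injective).
-- From level 0, colour c takes two steps that depend only on whether the e₃-coordinate k
-- vanishes (k + 1 for colour 1) and then m − 2 steps along e_{c+1}. In the coordinates
-- (k, i) of level 0 the return map is therefore an odometer: k advances by a constant ε,
-- and i by κ when k is at 0 and by ν otherwise. Such a map is transitive on (ℤ/m)² when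
-- ε and the drift κ + (m − 1)ν of one full turn of k are units: for colours 0 and 1,
-- ε = 1 and the drift is (m − 1)² and 1; for colour 2 both are −2, a unit as m is odd.
-- The arc decomposition is read off the table of directions: at every vertex the three
-- colours use the three directions.
module Submission where

open import Defs
open import Data.Nat using (ℕ; zero; suc; pred; _+_; _*_; _∸_; _≤_; _<_; NonZero; z≤n; s≤s; ≢-nonZero)
open import Data.Nat.Properties
  using ( +-comm; +-suc; +-assoc; +-identityʳ; *-suc; *-zeroʳ; *-comm; suc-pred; suc-injective
        ; ≤-refl; m≤n⇒m≤1+n; <⇒≤; <⇒≢; n<1+n; <-≤-trans; <-trans; m∸n+n≡m )
import Data.Nat.Properties as ℕ
open import Data.Nat.DivMod
  using ( _%_; _/_; m%n<n; m%n%n≡m%n; %-distribˡ-+; %-distribˡ-*; [m+kn]%n≡m%n; m*n%n≡0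
        ; m<n⇒m%n≡m; n%n≡0; m≡m%n+[m/n]*n )
open import Data.Nat.Tactic.RingSolver using (solve-∀)
open import Data.Fin using (Fin; toℕ)
import Data.Fin as Fin
open import Data.Fin.Patterns using (0F; 1F; 2F)
open import Data.Fin.Properties using (toℕ-injective; toℕ-fromℕ<; toℕ<n; _≟_)
open import Data.Bool using (true; false; if_then_else_)
open import Data.Product using (∃; _×_; _,_; proj₁; proj₂)
open import Function.Base using (_∘_)
open import Function.Definitions using (Injective)
open import Level using (0ℓ)
open import Relation.Binary.Bundles using (Setoid)
open import Relation.Binary.Structures using (IsEquivalence)
open import Relation.Binary.Definitions using (Decidable)
import Relation.Binary.Reasoning.Setoid as SetoidReasoning
open import Relation.Binary.PropositionalEquality
open import Relation.Nullary using (¬_; yes; no; does; contradiction)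
open import Relation.Nullary.Decidable using (dec-true; dec-false)

private variable
  A : Set

iterate-+ : (g : A → A) (a b : ℕ) (x : A) → iterate g (a + b) x ≡ iterate g a (iterate g b x)
iterate-+ g zero    b x = refl
iterate-+ g (suc a) b x = cong g (iterate-+ g a b x)

iterate-* : (g : A → A) (a b : ℕ) (x : A) → iterate g (a * b) x ≡ iterate (iterate g b) a x
iterate-* g zero    b x = refl
iterate-* g (suc a) b x = trans (iterate-+ g b (a * b) x) (cong (iterate g b) (iterate-* g a b x))

iterate-sucʳ : (g : A → A) (a : ℕ) (x : A) → iterate g (suc a) x ≡ iterate g a (g x)
iterate-sucʳ g zero    x = refl
iterate-sucʳ g (suc a) x = cong g (iterate-sucʳ g a x)

iterate-fixedPoint : (g : A → A) {x : A} → g x ≡ x → ∀ k → iterate g k x ≡ x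
iterate-fixedPoint g gx≡x zero    = refl
iterate-fixedPoint g gx≡x (suc k) = trans (cong g (iterate-fixedPoint g gx≡x k)) gx≡x

iterate-injective : (g : A → A) → Injective _≡_ _≡_ g → ∀ k → Injective _≡_ _≡_ (iterate g k)
iterate-injective g inj zero    eq = eq
iterate-injective g inj (suc k) eq = iterate-injective g inj k (inj eq)

-- g o runs into o, so o is periodic, and injectivity pulls the orbit of o back onto every w.
isHamiltonCycle-fromSink : (g : A → A) → Injective _≡_ _≡_ g → (o : A) →
                           (∀ w → ∃ λ k → iterate g k w ≡ o) → IsHamiltonCycle g
isHamiltonCycle-fromSink g inj o toSink = (inj , surjective) , connected
  where
  open ≡-Reasoning
  N : ℕ
  N = proj₁ (toSink (g o))

  periodic : iterate g (suc N) o ≡ o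
  periodic = trans (iterate-sucʳ g N o) (proj₂ (toSink (g o)))

  fromSink : ∀ w → ∃ λ k → iterate g k o ≡ w
  fromSink w = a * N , iterate-injective g inj a (begin
    iterate g a (iterate g (a * N) o)  ≡⟨ iterate-+ g a (a * N) o ⟨
    iterate g (a + a * N) o            ≡⟨ cong (λ k → iterate g k o) (*-suc a N) ⟨
    iterate g (a * suc N) o            ≡⟨ iterate-* g a (suc N) o ⟩
    iterate (iterate g (suc N)) a o    ≡⟨ iterate-fixedPoint (iterate g (suc N)) periodic a ⟩
    o                                  ≡⟨ proj₂ (toSink w) ⟨
    iterate g a w                      ∎)
    where a = proj₁ (toSink w)

  connected : ∀ v w → ∃ λ k → iterate g k v ≡ w
  connected v w = b + a , (begin
    iterate g (b + a) v          ≡⟨ iterate-+ g b a v ⟩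
    iterate g b (iterate g a v)  ≡⟨ cong (iterate g b) (proj₂ (toSink v)) ⟩
    iterate g b o                ≡⟨ proj₂ (fromSink w) ⟩
    w                            ∎)
    where a = proj₁ (toSink v)
          b = proj₁ (fromSink w)

  surjective : ∀ y → ∃ λ x → ∀ {z} → z ≡ x → g z ≡ y
  surjective y = iterate g (b + N) o , λ { refl → begin
    iterate g (suc (b + N)) o          ≡⟨ cong (λ k → iterate g k o) (+-suc b N) ⟨
    iterate g (b + suc N) o            ≡⟨ iterate-+ g b (suc N) o ⟩
    iterate g b (iterate g (suc N) o)  ≡⟨ cong (iterate g b) periodic ⟩
    iterate g b o                      ≡⟨ proj₂ (fromSink y) ⟩
    y                                  ∎ }
    where b = proj₁ (fromSink y)

module Modular (m′ : ℕ) where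

  m : ℕ
  m = suc m′

  infix 4 _≈_ _≈?_
  -- opaque, so that a % m does not unfold into mod-helper and the arguments of _≈_ stay inferable
  opaque
    _≈_ : ℕ → ℕ → Set
    a ≈ b = a % m ≡ b % m

  opaque
    unfolding _≈_

    ≈-isEquivalence : IsEquivalence _≈_
    ≈-isEquivalence = record { refl = refl ; sym = sym ; trans = trans }

    _≈?_ : Decidable _≈_
    a ≈? b = a % m ℕ.≟ b % m

    %≡⇒≈ : ∀ {a b} → a % m ≡ b % m → a ≈ b
    %≡⇒≈ eq = eq

    ≈⇒%≡ : ∀ {a b} → a ≈ b → a % m ≡ b % m
    ≈⇒%≡ eq = eq

    ≡⇒≈ : ∀ {a b} → a ≡ b → a ≈ b
    ≡⇒≈ = cong (_% m)

    %-≈ : ∀ a → a % m ≈ a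
    %-≈ a = m%n%n≡m%n a m

    +-cong : ∀ {a b c d} → a ≈ b → c ≈ d → a + c ≈ b + d
    +-cong {a} {b} {c} {d} a≈b c≈d = begin
      (a + c) % m              ≡⟨ %-distribˡ-+ a c m ⟩
      (a % m + c % m) % m      ≡⟨ cong₂ (λ x y → (x + y) % m) a≈b c≈d ⟩
      (b % m + d % m) % m      ≡⟨ %-distribˡ-+ b d m ⟨
      (b + d) % m              ∎
      where open ≡-Reasoning

    *-congˡ : ∀ a {b c} → b ≈ c → a * b ≈ a * c
    *-congˡ a {b} {c} b≈c = begin
      (a * b) % m              ≡⟨ %-distribˡ-* a b m ⟩
      (a % m * (b % m)) % m    ≡⟨ cong (λ y → (a % m * y) % m) b≈c ⟩
      (a % m * (c % m)) % m    ≡⟨ %-distribˡ-* a c m ⟨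
      (a * c) % m              ∎
      where open ≡-Reasoning

    *m≈0 : ∀ k → k * m ≈ 0
    *m≈0 k = m*n%n≡0 k m

    +*m≈ : ∀ a k → a + k * m ≈ a
    +*m≈ a k = [m+kn]%n≡m%n a k m

    ≈⇒≡ : ∀ {a b} → a < m → b < m → a ≈ b → a ≡ b
    ≈⇒≡ a<m b<m eq = trans (sym (m<n⇒m%n≡m a<m)) (trans eq (m<n⇒m%n≡m b<m))

  ≈-setoid : Setoid 0ℓ 0ℓ
  ≈-setoid = record { isEquivalence = ≈-isEquivalence }

  open Setoid ≈-setoid public using () renaming (refl to ≈-refl; sym to ≈-sym; trans to ≈-trans)
  module ≈-Reasoning = SetoidReasoning ≈-setoid

  +-congˡ : ∀ a {b c} → b ≈ c → a + b ≈ a + c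
  +-congˡ a = +-cong {a} ≈-refl

  *-congʳ : ∀ a {b c} → b ≈ c → b * a ≈ c * a
  *-congʳ a {b} {c} b≈c = subst₂ _≈_ (*-comm a b) (*-comm a c) (*-congˡ a b≈c)

  +-cancelˡ : ∀ a {b c} → a + b ≈ a + c → b ≈ c
  +-cancelˡ a {b} {c} eq = begin
    b                           ≈⟨ +*m≈ b a ⟨
    b + a * m                   ≡⟨ shift b ⟩
    m′ * a + (a + b)            ≈⟨ +-congˡ (m′ * a) eq ⟩
    m′ * a + (a + c)            ≡⟨ shift c ⟨
    c + a * m                   ≈⟨ +*m≈ c a ⟩
    c                           ∎
    where
    open ≈-Reasoning
    shift : ∀ x → x + a * m ≡ m′ * a + (a + x)
    shift x = lemma x a m′
      where lemma : ∀ x a p → x + a * suc p ≡ p * a + (a + x)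
            lemma = solve-∀

  +-cancelʳ : ∀ a {b c} → b + a ≈ c + a → b ≈ c
  +-cancelʳ a {b} {c} eq = +-cancelˡ a (subst₂ _≈_ (+-comm b a) (+-comm c a) eq)

  ≈0⇒≡0 : ∀ {a} → a < m → a ≈ 0 → a ≡ 0
  ≈0⇒≡0 a<m = ≈⇒≡ a<m (s≤s z≤n)

  ≉0⇒≡suc : ∀ {a} → ¬ a ≈ 0 → a ≡ suc (pred a)
  ≉0⇒≡suc {a} a≉0 = sym (suc-pred a {{≢-nonZero (a≉0 ∘ ≡⇒≈)}})

  -- a unit ε of ℤ/m, given by μ with ε μ ≡ −1, which keeps the condition inside ℕ
  IsUnit : ℕ → Set
  IsUnit ε = ∃ λ μ → ε * μ + 1 ≈ 0

  isUnit-byMultiple : ∀ ε μ k → ε * μ + 1 ≡ k * m → IsUnit ε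
  isUnit-byMultiple ε μ k eq = μ , ≈-trans (≡⇒≈ eq) (*m≈0 k)

  unit-nonvanishing : ∀ {ε j} → IsUnit ε → 0 < j → j < m → ¬ j * ε ≈ 0
  unit-nonvanishing {ε} {j} (μ , εμ≈-1) 0<j j<m jε≈0 =
    <⇒≢ 0<j (≈⇒≡ (<-≤-trans 0<j (<⇒≤ j<m)) j<m (begin
      0                     ≡⟨ *-zeroʳ j ⟨
      j * 0                 ≈⟨ *-congˡ j εμ≈-1 ⟨
      j * (ε * μ + 1)       ≡⟨ lemma j ε μ ⟩
      j * ε * μ + j         ≈⟨ +-cong (*-congʳ μ jε≈0) ≈-refl ⟩
      j                     ∎))
    where
    open ≈-Reasoning
    lemma : ∀ j ε μ → j * (ε * μ + 1) ≡ j * ε * μ + j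
    lemma = solve-∀

  record IsTranslation (Q : A → Set) (β : A → ℕ) (ε : ℕ) (T : A → A) : Set where
    field translate : ∀ {x} → Q x → Q (T x) × β (T x) ≈ ε + β x

  module _ {Q : A → Set} {β : A → ℕ} {ε : ℕ} {T : A → A} (isTranslation : IsTranslation Q β ε T) where
    open IsTranslation isTranslation

    translation-iterate : ∀ {x} → Q x → ∀ k → Q (iterate T k x) × β (iterate T k x) ≈ k * ε + β x
    translation-iterate q zero    = q , ≈-refl
    translation-iterate {x} q (suc k) with translation-iterate q k
    ... | qₖ , βₖ = proj₁ (translate qₖ) , (begin
      β (T (iterate T k x))      ≈⟨ proj₂ (translate qₖ) ⟩
      ε + β (iterate T k x)      ≈⟨ +-congˡ ε βₖ ⟩
      ε + (k * ε + β x)          ≡⟨ +-assoc ε (k * ε) (β x) ⟨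
      suc k * ε + β x            ∎)
      where open ≈-Reasoning

    translation-reachesZero : IsUnit ε → ∀ {x} → Q x → ∃ λ k → Q (iterate T k x) × β (iterate T k x) ≈ 0
    translation-reachesZero (μ , εμ≈-1) {x} q = β x * μ , proj₁ (translation-iterate q (β x * μ)) , (begin
      β (iterate T (β x * μ) x)  ≈⟨ proj₂ (translation-iterate q (β x * μ)) ⟩
      β x * μ * ε + β x          ≡⟨ lemma (β x) μ ε ⟩
      β x * (ε * μ + 1)          ≈⟨ *-congˡ (β x) εμ≈-1 ⟩
      β x * 0                    ≡⟨ *-zeroʳ (β x) ⟩
      0                          ∎)
      where
      open ≈-Reasoning
      lemma : ∀ b μ ε → b * μ * ε + b ≡ b * (ε * μ + 1)
      lemma = solve-∀

  record IsOdometer (P : A → Set) (R : A → A) (γ α : A → ℕ) (ε κ ν : ℕ) : Set where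
    field
      invariant : ∀ {x} → P x → P (R x)
      carry     : ∀ {x} → P x → γ x ≈ 0 → γ (R x) ≈ ε + γ x × α (R x) ≈ κ + α x
      no-carry  : ∀ {x} → P x → ¬ γ x ≈ 0 → γ (R x) ≈ ε + γ x × α (R x) ≈ ν + α x

  module Odometer {P : A → Set} {R : A → A} {γ α : A → ℕ} {ε κ ν : ℕ}
                  (odometer : IsOdometer P R γ α ε κ ν) where
    open IsOdometer odometer
    open ≈-Reasoning

    fast-isTranslation : IsTranslation P γ ε R
    fast-isTranslation = record { translate = step }
      where
      step : ∀ {x} → P x → P (R x) × γ (R x) ≈ ε + γ x
      step {x} p with γ x ≈? 0
      ... | yes γ≈0 = invariant p , proj₁ (carry p γ≈0)
      ... | no  γ≉0 = invariant p , proj₁ (no-carry p γ≉0)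

    -- while the fast digit runs once around ℤ/m it passes 0 only at the start
    carriesOnce : IsUnit ε → ∀ {x} → P x → γ x ≈ 0 → ∀ j → j < m →
                  α (iterate R (suc j) x) ≈ κ + (j * ν + α x)
    carriesOnce ε-unit p γ≈0 zero    _    = proj₂ (carry p γ≈0)
    carriesOnce ε-unit {x} p γ≈0 (suc j) 1+j<m with translation-iterate fast-isTranslation p (suc j)
    ... | pʸ , γʸ = begin
      α (R y)                    ≈⟨ proj₂ (no-carry pʸ γʸ≉0) ⟩
      ν + α y                    ≈⟨ +-congˡ ν (carriesOnce ε-unit p γ≈0 j (<-trans (n<1+n j) 1+j<m)) ⟩
      ν + (κ + (j * ν + α x))    ≡⟨ lemma ν κ (j * ν) (α x) ⟩
      κ + (suc j * ν + α x)      ∎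
      where
      y = iterate R (suc j) x
      lemma : ∀ a b c d → a + (b + (c + d)) ≡ b + (a + c + d)
      lemma = solve-∀
      γʸ≉0 : ¬ γ y ≈ 0
      γʸ≉0 γʸ≈0 = unit-nonvanishing ε-unit (s≤s z≤n) 1+j<m (begin
        suc j * ε                ≡⟨ +-identityʳ (suc j * ε) ⟨
        suc j * ε + 0            ≈⟨ +-congˡ (suc j * ε) γ≈0 ⟨
        suc j * ε + γ x          ≈⟨ γʸ ⟨
        γ y                      ≈⟨ γʸ≈0 ⟩
        0                        ∎)

    fullTurn-isTranslation : IsUnit ε → IsTranslation (λ x → P x × γ x ≈ 0) α (κ + m′ * ν) (iterate R m)
    fullTurn-isTranslation ε-unit = record { translate = turn }
      where
      turn : ∀ {x} → P x × γ x ≈ 0 →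
             (P (iterate R m x) × γ (iterate R m x) ≈ 0) × α (iterate R m x) ≈ κ + m′ * ν + α x
      turn {x} (p , γ≈0) = (proj₁ (translation-iterate fast-isTranslation p m) , γ-turn) , α-turn
        where
        γ-turn : γ (iterate R m x) ≈ 0
        γ-turn = begin
          γ (iterate R m x)  ≈⟨ proj₂ (translation-iterate fast-isTranslation p m) ⟩
          m * ε + γ x        ≈⟨ +-cong (≡⇒≈ (*-comm m ε)) γ≈0 ⟩
          ε * m + 0          ≈⟨ +-cong (*m≈0 ε) ≈-refl ⟩
          0                  ∎
        α-turn : α (iterate R m x) ≈ κ + m′ * ν + α x
        α-turn = ≈-trans (carriesOnce ε-unit p γ≈0 m′ (n<1+n m′))
                         (≡⇒≈ (sym (+-assoc κ (m′ * ν) (α x))))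

    reachesOrigin : IsUnit ε → IsUnit (κ + m′ * ν) → ∀ {x} → P x →
                    ∃ λ k → P (iterate R k x) × γ (iterate R k x) ≈ 0 × α (iterate R k x) ≈ 0
    reachesOrigin ε-unit turn-unit {x} p with translation-reachesZero fast-isTranslation ε-unit p
    ... | k₁ , p₁ , γ₁ with translation-reachesZero (fullTurn-isTranslation ε-unit) turn-unit (p₁ , γ₁)
    ... | k₂ , (p₂ , γ₂) , α₂ =
      k₂ * m + k₁ , subst (λ y → P y × γ y ≈ 0 × α y ≈ 0) (sym path) (p₂ , γ₂ , α₂)
      where
      path : iterate R (k₂ * m + k₁) x ≡ iterate (iterate R m) k₂ (iterate R k₁ x)
      path = trans (iterate-+ R (k₂ * m) k₁ x) (iterate-* R k₂ m (iterate R k₁ x))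

pattern e₁ = 0F
pattern e₂ = 1F
pattern e₃ = 2F

-- direction of the arc of colour c at a vertex of level s whose e₃-coordinate is a
dir : Fin 3 → ℕ → ℕ → Fin 3
dir c  (suc (suc _)) _       = c
dir 0F 0             0       = e₁
dir 0F 0             (suc _) = e₂
dir 0F 1             _       = e₃
dir 1F 0             _       = e₃
dir 1F 1             0       = e₁
dir 1F 1             (suc _) = e₂
dir 2F 0             0       = e₂
dir 2F 0             (suc _) = e₁
dir 2F 1             0       = e₂
dir 2F 1             (suc _) = e₁

colourOf : ℕ → ℕ → Fin 3 → Fin 3
colourOf (suc (suc _)) _       d  = d
colourOf 0             _       e₃ = 1F
colourOf 1             _       e₃ = 0F
colourOf 0             0       e₁ = 0F
colourOf 0             0       e₂ = 2F
colourOf 0             (suc _) e₁ = 2F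
colourOf 0             (suc _) e₂ = 0F
colourOf 1             0       e₁ = 1F
colourOf 1             0       e₂ = 2F
colourOf 1             (suc _) e₁ = 2F
colourOf 1             (suc _) e₂ = 1F

dir-colourOf : ∀ s a d → dir (colourOf s a d) s a ≡ d
dir-colourOf (suc (suc _)) _       _  = refl
dir-colourOf 0             _       e₃ = refl
dir-colourOf 1             _       e₃ = refl
dir-colourOf 0             0       e₁ = refl
dir-colourOf 0             0       e₂ = refl
dir-colourOf 0             (suc _) e₁ = refl
dir-colourOf 0             (suc _) e₂ = refl
dir-colourOf 1             0       e₁ = refl
dir-colourOf 1             0       e₂ = refl
dir-colourOf 1             (suc _) e₁ = refl
dir-colourOf 1             (suc _) e₂ = refl

colourOf-dir : ∀ c s a → colourOf s a (dir c s a) ≡ c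
colourOf-dir _  (suc (suc _)) _       = refl
colourOf-dir 0F 0             0       = refl
colourOf-dir 0F 0             (suc _) = refl
colourOf-dir 0F 1             _       = refl
colourOf-dir 1F 0             _       = refl
colourOf-dir 1F 1             0       = refl
colourOf-dir 1F 1             (suc _) = refl
colourOf-dir 2F 0             0       = refl
colourOf-dir 2F 0             (suc _) = refl
colourOf-dir 2F 1             0       = refl
colourOf-dir 2F 1             (suc _) = refl

colourOf-e₃ : ∀ s a b → colourOf s a e₃ ≡ colourOf s b e₃
colourOf-e₃ (suc (suc _)) _ _ = refl
colourOf-e₃ 0             _ _ = refl
colourOf-e₃ 1             _ _ = refl

dir≡e₃-independent : ∀ c s {a b} → dir c s a ≡ e₃ → dir c s b ≡ e₃
dir≡e₃-independent c s {a} {b} eq = begin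
  dir c s b                      ≡⟨ cong (λ c → dir c s b) c≡ ⟩
  dir (colourOf s b e₃) s b      ≡⟨ dir-colourOf s b e₃ ⟩
  e₃                             ∎
  where
  open ≡-Reasoning
  c≡ : c ≡ colourOf s b e₃
  c≡ = trans (sym (colourOf-dir c s a)) (trans (cong (colourOf s a) eq) (colourOf-e₃ s a b))

module Torus (m′ : ℕ) where
  open Modular m′

  coord : Fin 3 → V m → ℕ
  coord e₁ (i , _ , _) = toℕ i
  coord e₂ (_ , j , _) = toℕ j
  coord e₃ (_ , _ , k) = toℕ k

  coord<m : ∀ e v → coord e v < m
  coord<m e₁ (i , _ , _) = toℕ<n i
  coord<m e₂ (_ , j , _) = toℕ<n j
  coord<m e₃ (_ , _ , k) = toℕ<n k

  toℕ-≈-injective : ∀ {x y : Fin m} → toℕ x ≈ toℕ y → x ≡ y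
  toℕ-≈-injective {x} {y} eq = toℕ-injective (≈⇒≡ (toℕ<n x) (toℕ<n y) eq)

  coord-ext : ∀ {v w} → (∀ e → coord e v ≈ coord e w) → v ≡ w
  coord-ext eq =
    cong₂ _,_ (toℕ-≈-injective (eq e₁)) (cong₂ _,_ (toℕ-≈-injective (eq e₂)) (toℕ-≈-injective (eq e₃)))

  toℕ-incr : ∀ x → toℕ (incr m x) ≈ suc (toℕ x)
  toℕ-incr x = ≈-trans (≡⇒≈ (toℕ-fromℕ< (m%n<n (suc (toℕ x)) m))) (%-≈ (suc (toℕ x)))

  -- the e-coordinate of the displacement L e_d
  along : Fin 3 → ℕ → Fin 3 → ℕ
  along d L e = if does (d ≟ e) then L else 0

  along-self : ∀ d L → along d L d ≡ L
  along-self d L rewrite dec-true (d ≟ d) refl = refl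

  along-other : ∀ {d e} L → d ≢ e → along d L e ≡ 0
  along-other {d} {e} L d≢e rewrite dec-false (d ≟ e) d≢e = refl

  along-zero : ∀ d e → along d 0 e ≡ 0
  along-zero d e with does (d ≟ e)
  ... | true  = refl
  ... | false = refl

  along-suc : ∀ d e L → along d 1 e + along d L e ≡ along d (suc L) e
  along-suc d e L with does (d ≟ e)
  ... | true  = refl
  ... | false = refl

  coord-bump : ∀ d e v → coord e (bump m d v) ≈ along d 1 e + coord e v
  coord-bump e₁ e₁ (i , _ , _) = toℕ-incr i
  coord-bump e₁ e₂ _           = ≈-refl
  coord-bump e₁ e₃ _           = ≈-refl
  coord-bump e₂ e₁ _           = ≈-refl
  coord-bump e₂ e₂ (_ , j , _) = toℕ-incr j
  coord-bump e₂ e₃ _           = ≈-refl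
  coord-bump e₃ e₁ _           = ≈-refl
  coord-bump e₃ e₂ _           = ≈-refl
  coord-bump e₃ e₃ (_ , _ , k) = toℕ-incr k

  coord-bump-other : ∀ {d e} v → d ≢ e → coord e (bump m d v) ≡ coord e v
  coord-bump-other {d} {e} v d≢e = ≈⇒≡ (coord<m e (bump m d v)) (coord<m e v)
    (≈-trans (coord-bump d e v) (≡⇒≈ (cong (_+ coord e v) (along-other 1 d≢e))))

  coord-iterate-bump : ∀ d e L v → coord e (iterate (bump m d) L v) ≈ along d L e + coord e v
  coord-iterate-bump d e zero    v = ≡⇒≈ (cong (_+ coord e v) (sym (along-zero d e)))
  coord-iterate-bump d e (suc L) v = begin
    coord e (bump m d (iterate (bump m d) L v))     ≈⟨ coord-bump d e _ ⟩
    along d 1 e + coord e (iterate (bump m d) L v)  ≈⟨ +-congˡ (along d 1 e) (coord-iterate-bump d e L v) ⟩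
    along d 1 e + (along d L e + coord e v)         ≡⟨ +-assoc (along d 1 e) (along d L e) (coord e v) ⟨
    along d 1 e + along d L e + coord e v           ≡⟨ cong (_+ coord e v) (along-suc d e L) ⟩
    along d (suc L) e + coord e v                   ∎
    where open ≈-Reasoning

  bump-injective : ∀ d → Injective _≡_ _≡_ (bump m d)
  bump-injective d {v} {w} eq = coord-ext λ e → +-cancelˡ (along d 1 e) (begin
    along d 1 e + coord e v  ≈⟨ coord-bump d e v ⟨
    coord e (bump m d v)     ≡⟨ cong (coord e) eq ⟩
    coord e (bump m d w)     ≈⟨ coord-bump d e w ⟩
    along d 1 e + coord e w  ∎)
    where open ≈-Reasoning

  bump-direction-injective : 1 < m → ∀ {d d′} v → bump m d v ≡ bump m d′ v → d ≡ d′
  bump-direction-injective 1<m {d} {d′} v eq with d ≟ d′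
  ... | yes d≡d′ = d≡d′
  ... | no  d≢d′ = contradiction (≈⇒≡ 1<m (s≤s z≤n) (+-cancelʳ (coord d v) (begin
    1 + coord d v              ≡⟨ cong (_+ coord d v) (along-self d 1) ⟨
    along d 1 d + coord d v    ≈⟨ coord-bump d d v ⟨
    coord d (bump m d v)       ≡⟨ cong (coord d) eq ⟩
    coord d (bump m d′ v)      ≈⟨ coord-bump d′ d v ⟩
    along d′ 1 d + coord d v   ≡⟨ cong (_+ coord d v) (along-other 1 (d≢d′ ∘ sym)) ⟩
    0 + coord d v              ∎))) λ ()
    where open ≈-Reasoning

  S-bump : ∀ d v → S m (bump m d v) ≡ suc (S m v) % m
  S-bump d v@(i , j , k) = ≈⇒%≡ (begin
    coord e₁ w + coord e₂ w + coord e₃ w                           ≈⟨ bumped ⟩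
    along d 1 e₁ + c₁ + (along d 1 e₂ + c₂) + (along d 1 e₃ + c₃)  ≡⟨ one-step d ⟩
    suc (c₁ + c₂ + c₃)                                             ≈⟨ +-congˡ 1 (%-≈ (c₁ + c₂ + c₃)) ⟨
    suc (S m v)                                                    ∎)
    where
    open ≈-Reasoning
    w = bump m d v
    c₁ = toℕ i
    c₂ = toℕ j
    c₃ = toℕ k
    bumped = +-cong (+-cong (coord-bump d e₁ v) (coord-bump d e₂ v)) (coord-bump d e₃ v)
    one-step : ∀ d → along d 1 e₁ + c₁ + (along d 1 e₂ + c₂) + (along d 1 e₃ + c₃) ≡ suc (c₁ + c₂ + c₃)
    one-step e₁ = refl
    one-step e₂ = cong (_+ c₃) (+-suc c₁ c₂)
    one-step e₃ = +-suc (c₁ + c₂) c₃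

  f-dir : ∀ c v → f m c v ≡ bump m (dir c (S m v) (coord e₃ v)) v
  f-dir 0F (i , j , k) with toℕ k | S m (i , j , k)
  ... | 0     | 0           = refl
  ... | suc _ | 0           = refl
  ... | _     | 1           = refl
  ... | _     | suc (suc _) = refl
  f-dir 1F (i , j , k) with toℕ k | S m (i , j , k)
  ... | _     | 0           = refl
  ... | 0     | 1           = refl
  ... | suc _ | 1           = refl
  ... | _     | suc (suc _) = refl
  f-dir 2F (i , j , k) with toℕ k | S m (i , j , k)
  ... | 0     | 0           = refl
  ... | suc _ | 0           = refl
  ... | 0     | 1           = refl
  ... | suc _ | 1           = refl
  ... | _     | suc (suc _) = refl

  f-step : ∀ c {v s d} → S m v ≡ s → dir c s (coord e₃ v) ≡ d → f m c v ≡ bump m d v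
  f-step c {v} refl refl = f-dir c v

  S-f : ∀ c v → S m (f m c v) ≡ suc (S m v) % m
  S-f c v = trans (cong (S m) (f-dir c v)) (S-bump (dir c (S m v) (coord e₃ v)) v)

  S<m : ∀ v → S m v < m
  S<m (i , j , k) = m%n<n (toℕ i + toℕ j + toℕ k) m

  S-iterate : ∀ c L v → S m (iterate (f m c) L v) ≡ (L + S m v) % m
  S-iterate c zero    v = sym (m<n⇒m%n≡m (S<m v))
  S-iterate c (suc L) v = begin
    S m (f m c (iterate (f m c) L v))    ≡⟨ S-f c (iterate (f m c) L v) ⟩
    suc (S m (iterate (f m c) L v)) % m  ≡⟨ cong (λ s → suc s % m) (S-iterate c L v) ⟩
    suc ((L + S m v) % m) % m            ≡⟨ ≈⇒%≡ (+-congˡ 1 (%-≈ (L + S m v))) ⟩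
    suc (L + S m v) % m                  ∎
    where open ≡-Reasoning

  f-level-injective : ∀ c {x y} → f m c x ≡ f m c y → S m x ≡ S m y
  f-level-injective c {x} {y} eq = ≈⇒≡ (S<m x) (S<m y) (+-cancelˡ 1 (%≡⇒≈ (begin
    suc (S m x) % m  ≡⟨ S-f c x ⟨
    S m (f m c x)    ≡⟨ cong (S m) eq ⟩
    S m (f m c y)    ≡⟨ S-f c y ⟩
    suc (S m y) % m  ∎)))
    where open ≡-Reasoning

  -- the colour using direction e₃ at a level does not depend on the vertex,
  -- and the other two directions leave the e₃-coordinate unchanged
  dir-determined : ∀ c s {x y} → bump m (dir c s (coord e₃ x)) x ≡ bump m (dir c s (coord e₃ y)) y →
                   dir c s (coord e₃ x) ≡ dir c s (coord e₃ y)
  dir-determined c s {x} {y} eq with dir c s (coord e₃ x) ≟ e₃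
  ... | yes dˣ≡e₃ = trans dˣ≡e₃ (sym (dir≡e₃-independent c s {coord e₃ x} {coord e₃ y} dˣ≡e₃))
  ... | no  dˣ≢e₃ = cong (dir c s) (begin
    coord e₃ x                                    ≡⟨ coord-bump-other x dˣ≢e₃ ⟨
    coord e₃ (bump m (dir c s (coord e₃ x)) x)    ≡⟨ cong (coord e₃) eq ⟩
    coord e₃ (bump m (dir c s (coord e₃ y)) y)    ≡⟨ coord-bump-other y dʸ≢e₃ ⟩
    coord e₃ y                                    ∎)
    where
    open ≡-Reasoning
    dʸ≢e₃ : dir c s (coord e₃ y) ≢ e₃
    dʸ≢e₃ = dˣ≢e₃ ∘ dir≡e₃-independent c s {coord e₃ y} {coord e₃ x}

  f-injective : ∀ c → Injective _≡_ _≡_ (f m c)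
  f-injective c {x} {y} eq = bump-injective (dir c (S m x) (coord e₃ x)) (begin
    bump m (dir c (S m x) (coord e₃ x)) x  ≡⟨ bumps≡ ⟩
    bump m (dir c (S m x) (coord e₃ y)) y  ≡⟨ cong (λ d → bump m d y) (dir-determined c (S m x) bumps≡) ⟨
    bump m (dir c (S m x) (coord e₃ x)) y  ∎)
    where
    open ≡-Reasoning
    bumps≡ : bump m (dir c (S m x) (coord e₃ x)) x ≡ bump m (dir c (S m x) (coord e₃ y)) y
    bumps≡ = begin
      bump m (dir c (S m x) (coord e₃ x)) x  ≡⟨ f-dir c x ⟨
      f m c x                                ≡⟨ eq ⟩
      f m c y                                ≡⟨ f-dir c y ⟩
      bump m (dir c (S m y) (coord e₃ y)) y  ≡⟨ cong (λ s → bump m (dir c s (coord e₃ y)) y)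
                                                     (f-level-injective c eq) ⟨
      bump m (dir c (S m x) (coord e₃ y)) y  ∎

  isArcDecomposition : 1 < m → IsArcDecomposition m (f m)
  isArcDecomposition 1<m = (λ c v → dir c (S m v) (coord e₃ v) , f-dir c v) , uniqueColour
    where
    uniqueColour : ∀ d v → ∃ λ c → f m c v ≡ bump m d v × (∀ c′ → f m c′ v ≡ bump m d v → c′ ≡ c)
    uniqueColour d v = colourOf s a d , f-step (colourOf s a d) refl (dir-colourOf s a d) , unique
      where
      s = S m v
      a = coord e₃ v
      unique : ∀ c′ → f m c′ v ≡ bump m d v → c′ ≡ colourOf s a d
      unique c′ eq = trans (sym (colourOf-dir c′ s a))
                           (cong (colourOf s a) (bump-direction-injective 1<m v (trans (sym (f-dir c′ v)) eq)))

  level₀-ext : ∀ {v w} → S m v ≡ 0 → S m w ≡ 0 →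
               coord e₁ v ≈ coord e₁ w → coord e₃ v ≈ coord e₃ w → v ≡ w
  level₀-ext {v} {w} Sv≡0 Sw≡0 eq₁ eq₃ = coord-ext λ { e₁ → eq₁ ; e₂ → eq₂ ; e₃ → eq₃ }
    where
    open ≈-Reasoning
    eq₂ : coord e₂ v ≈ coord e₂ w
    eq₂ = +-cancelˡ (coord e₁ v) (+-cancelʳ (coord e₃ v) (begin
      coord e₁ v + coord e₂ v + coord e₃ v  ≈⟨ %≡⇒≈ (trans Sv≡0 (sym Sw≡0)) ⟩
      coord e₁ w + coord e₂ w + coord e₃ w  ≈⟨ +-cong (+-cong (≈-sym eq₁) ≈-refl) (≈-sym eq₃) ⟩
      coord e₁ v + coord e₂ w + coord e₃ v  ∎))

module ReturnMap (n : ℕ) where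
  open Modular (suc (suc n))
  open Torus (suc (suc n))

  Level₀ : V m → Set
  Level₀ v = S m v ≡ 0

  returnMap : Fin 3 → V m → V m
  returnMap c = iterate (f m c) m

  returnMap-level₀ : ∀ c {v} → Level₀ v → Level₀ (returnMap c v)
  returnMap-level₀ c {v} lvl = begin
    S m (iterate (f m c) m v)  ≡⟨ S-iterate c m v ⟩
    (m + S m v) % m            ≡⟨ cong (λ s → (m + s) % m) lvl ⟩
    (m + 0) % m                ≡⟨ ≈⇒%≡ (*m≈0 1) ⟩
    0                          ∎
    where open ≡-Reasoning

  upper-sweep : ∀ c L {v} → S m v ≡ 2 → L ≤ suc n → iterate (f m c) L v ≡ iterate (bump m c) L v
  upper-sweep c zero    _   _         = refl
  upper-sweep c (suc L) {v} lvl (s≤s L≤n) =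
    trans (f-step c level refl) (cong (bump m c) (upper-sweep c L lvl (m≤n⇒m≤1+n L≤n)))
    where
    level : S m (iterate (f m c) L v) ≡ suc (suc L)
    level = begin
      S m (iterate (f m c) L v)  ≡⟨ S-iterate c L v ⟩
      (L + S m v) % m            ≡⟨ cong (λ s → (L + s) % m) lvl ⟩
      (L + 2) % m                ≡⟨ cong (_% m) (+-comm L 2) ⟩
      suc (suc L) % m            ≡⟨ m<n⇒m%n≡m (s≤s (s≤s (s≤s L≤n))) ⟩
      suc (suc L)                ∎
      where open ≡-Reasoning

  returnMap-path : ∀ c {v d₀ d₁} → Level₀ v →
                   dir c 0 (coord e₃ v) ≡ d₀ → dir c 1 (coord e₃ (bump m d₀ v)) ≡ d₁ →
                   returnMap c v ≡ iterate (bump m c) (suc n) (bump m d₁ (bump m d₀ v))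
  returnMap-path c {v} {d₀} {d₁} lvl d₀≡ d₁≡ = begin
    iterate g m v                               ≡⟨ cong (λ k → iterate g k v) (+-comm 2 (suc n)) ⟩
    iterate g (suc n + 2) v                     ≡⟨ iterate-+ g (suc n) 2 v ⟩
    iterate g (suc n) (g (g v))                 ≡⟨ upper-sweep c (suc n) level₂ ≤-refl ⟩
    iterate (bump m c) (suc n) (g (g v))        ≡⟨ cong (iterate (bump m c) (suc n)) step₂ ⟩
    iterate (bump m c) (suc n) (bump m d₁ (bump m d₀ v)) ∎
    where
    open ≡-Reasoning
    g = f m c
    step₁ : g v ≡ bump m d₀ v
    step₁ = f-step c lvl d₀≡
    level₁ : S m (bump m d₀ v) ≡ 1
    level₁ = trans (S-bump d₀ v) (cong (λ s → suc s % m) lvl)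
    step₂ : g (g v) ≡ bump m d₁ (bump m d₀ v)
    step₂ = trans (cong g step₁) (f-step c level₁ d₁≡)
    level₂ : S m (g (g v)) ≡ 2
    level₂ = trans (cong (S m) step₂) (trans (S-bump d₁ (bump m d₀ v)) (cong (λ s → suc s % m) level₁))

  returnMap-coord : ∀ c {v d₀ d₁} → Level₀ v →
                    dir c 0 (coord e₃ v) ≡ d₀ → dir c 1 (coord e₃ (bump m d₀ v)) ≡ d₁ →
                    ∀ e → coord e (returnMap c v) ≈ along d₀ 1 e + along d₁ 1 e + along c (suc n) e + coord e v
  returnMap-coord c {v} {d₀} {d₁} lvl d₀≡ d₁≡ e = begin
    coord e (returnMap c v)                     ≡⟨ cong (coord e) (returnMap-path c lvl d₀≡ d₁≡) ⟩
    coord e (iterate (bump m c) (suc n) v₂)     ≈⟨ coord-iterate-bump c e (suc n) v₂ ⟩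
    a + coord e v₂                              ≈⟨ +-congˡ a (coord-bump d₁ e v₁) ⟩
    a + (a₁ + coord e v₁)                       ≈⟨ +-congˡ a (+-congˡ a₁ (coord-bump d₀ e v)) ⟩
    a + (a₁ + (a₀ + coord e v))                 ≡⟨ lemma a₀ a₁ a (coord e v) ⟩
    a₀ + a₁ + a + coord e v                     ∎
    where
    open ≈-Reasoning
    a₀ = along d₀ 1 e
    a₁ = along d₁ 1 e
    a  = along c (suc n) e
    v₁ = bump m d₀ v
    v₂ = bump m d₁ v₁
    lemma : ∀ a₀ a₁ a x → a + (a₁ + (a₀ + x)) ≡ a₀ + a₁ + a + x
    lemma = solve-∀

  reachesLevel₀ : ∀ c w → Level₀ (iterate (f m c) (m ∸ S m w) w)
  reachesLevel₀ c w = begin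
    S m (iterate (f m c) (m ∸ S m w) w)  ≡⟨ S-iterate c (m ∸ S m w) w ⟩
    (m ∸ S m w + S m w) % m              ≡⟨ cong (_% m) (m∸n+n≡m (<⇒≤ (S<m w))) ⟩
    m % m                                ≡⟨ n%n≡0 m ⟩
    0                                    ∎
    where open ≡-Reasoning

  isHamiltonCycle-fromOdometer :
    ∀ c {γ α ε κ ν} → IsOdometer Level₀ (returnMap c) γ α ε κ ν →
    IsUnit ε → IsUnit (κ + suc (suc n) * ν) →
    (∀ {v w} → Level₀ v → Level₀ w → γ v ≈ γ w → α v ≈ α w → v ≡ w) → IsHamiltonCycle (f m c)
  isHamiltonCycle-fromOdometer c {γ} {α} odometer ε-unit turn-unit γα-determine =
    isHamiltonCycle-fromSink g (f-injective c) o toSink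
    where
    open Odometer odometer using (reachesOrigin)
    g = f m c

    AtOrigin : V m → Set
    AtOrigin z = Level₀ z × γ z ≈ 0 × α z ≈ 0

    origin-unique : ∀ {z z′} → AtOrigin z → AtOrigin z′ → z ≡ z′
    origin-unique (p , γz , αz) (p′ , γz′ , αz′) =
      γα-determine p p′ (≈-trans γz (≈-sym γz′)) (≈-trans αz (≈-sym αz′))

    reached : ∀ {v} → Level₀ v → ∃ λ k → AtOrigin (iterate (returnMap c) k v)
    reached = reachesOrigin ε-unit turn-unit

    zero³ : V m
    zero³ = Fin.zero , Fin.zero , Fin.zero

    o : V m
    o = iterate (returnMap c) (proj₁ (reached {zero³} refl)) zero³

    toSink : ∀ w → ∃ λ k → iterate g k w ≡ o
    toSink w = k * m + L , (begin
      iterate g (k * m + L) w                  ≡⟨ iterate-+ g (k * m) L w ⟩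
      iterate g (k * m) (iterate g L w)        ≡⟨ iterate-* g k m (iterate g L w) ⟩
      iterate (returnMap c) k (iterate g L w)  ≡⟨ origin-unique (proj₂ w-reached) (proj₂ (reached refl)) ⟩
      o                                        ∎)
      where
      open ≡-Reasoning
      L = m ∸ S m w
      w-reached = reached (reachesLevel₀ c w)
      k = proj₁ w-reached

  isUnit-1 : IsUnit 1
  isUnit-1 = isUnit-byMultiple 1 (suc (suc n)) 1 (lemma n)
    where lemma : ∀ n → 1 * suc (suc n) + 1 ≡ 1 * suc (suc (suc n))
          lemma = solve-∀

  -- once d₀ and d₁ are known, returnMap-coord yields the displacements of both digits by evaluation
  odometer₀ : IsOdometer Level₀ (returnMap 0F) (coord e₃) (coord e₁) 1 (suc (suc n)) (suc n)
  odometer₀ = record { invariant = returnMap-level₀ 0F ; carry = carry ; no-carry = no-carry }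
    where
    carry : ∀ {v} → Level₀ v → coord e₃ v ≈ 0 →
            coord e₃ (returnMap 0F v) ≈ 1 + coord e₃ v × coord e₁ (returnMap 0F v) ≈ suc (suc n) + coord e₁ v
    carry {v} lvl k≈0 = displacement e₃ , displacement e₁
      where displacement = returnMap-coord 0F lvl (cong (dir 0F 0) (≈0⇒≡0 (coord<m e₃ v) k≈0)) refl
    no-carry : ∀ {v} → Level₀ v → ¬ coord e₃ v ≈ 0 →
               coord e₃ (returnMap 0F v) ≈ 1 + coord e₃ v × coord e₁ (returnMap 0F v) ≈ suc n + coord e₁ v
    no-carry {v} lvl k≉0 = displacement e₃ , displacement e₁
      where displacement = returnMap-coord 0F lvl (cong (dir 0F 0) (≉0⇒≡suc k≉0)) refl

  f₀-isHamiltonCycle : IsHamiltonCycle (f m 0F)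
  f₀-isHamiltonCycle =
    isHamiltonCycle-fromOdometer 0F odometer₀ isUnit-1 turn-unit (λ p q γ≈ α≈ → level₀-ext p q α≈ γ≈)
    where
    turn-unit : IsUnit (suc (suc n) + suc (suc n) * suc n)
    turn-unit = isUnit-byMultiple (suc (suc n) + suc (suc n) * suc n) (suc (suc n)) (n * n + 3 * n + 3) (lemma n)
      where lemma : ∀ n → (suc (suc n) + suc (suc n) * suc n) * suc (suc n) + 1
                          ≡ (n * n + 3 * n + 3) * suc (suc (suc n))
            lemma = solve-∀

  odometer₁ : IsOdometer Level₀ (returnMap 1F) (suc ∘ coord e₃) (coord e₁) 1 1 0
  odometer₁ = record { invariant = returnMap-level₀ 1F ; carry = carry ; no-carry = no-carry }
    where
    carry : ∀ {v} → Level₀ v → suc (coord e₃ v) ≈ 0 →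
            suc (coord e₃ (returnMap 1F v)) ≈ 1 + suc (coord e₃ v) ×
            coord e₁ (returnMap 1F v) ≈ 1 + coord e₁ v
    carry {v} lvl k+1≈0 = +-congˡ 1 (displacement e₃) , displacement e₁
      where displacement = returnMap-coord 1F lvl refl
              (cong (dir 1F 1) (≈0⇒≡0 (coord<m e₃ (bump m e₃ v)) (≈-trans (coord-bump e₃ e₃ v) k+1≈0)))
    no-carry : ∀ {v} → Level₀ v → ¬ suc (coord e₃ v) ≈ 0 →
               suc (coord e₃ (returnMap 1F v)) ≈ 1 + suc (coord e₃ v) ×
               coord e₁ (returnMap 1F v) ≈ 0 + coord e₁ v
    no-carry {v} lvl k+1≉0 = +-congˡ 1 (displacement e₃) , displacement e₁
      where displacement = returnMap-coord 1F lvl refl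
              (cong (dir 1F 1) (≉0⇒≡suc (k+1≉0 ∘ ≈-trans (≈-sym (coord-bump e₃ e₃ v)))))

  f₁-isHamiltonCycle : IsHamiltonCycle (f m 1F)
  f₁-isHamiltonCycle =
    isHamiltonCycle-fromOdometer 1F odometer₁ isUnit-1 turn-unit
      (λ p q γ≈ α≈ → level₀-ext p q α≈ (+-cancelˡ 1 γ≈))
    where
    turn-unit : IsUnit (1 + suc (suc n) * 0)
    turn-unit = isUnit-byMultiple (1 + suc (suc n) * 0) (suc (suc n)) 1 (lemma n)
      where lemma : ∀ n → (1 + suc (suc n) * 0) * suc (suc n) + 1 ≡ 1 * suc (suc (suc n))
            lemma = solve-∀

  odometer₂ : IsOdometer Level₀ (returnMap 2F) (coord e₃) (coord e₁) (suc n) 0 2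
  odometer₂ = record { invariant = returnMap-level₀ 2F ; carry = carry ; no-carry = no-carry }
    where
    carry : ∀ {v} → Level₀ v → coord e₃ v ≈ 0 →
            coord e₃ (returnMap 2F v) ≈ suc n + coord e₃ v × coord e₁ (returnMap 2F v) ≈ 0 + coord e₁ v
    carry {v} lvl k≈0 = displacement e₃ , displacement e₁
      where k≡0 = ≈0⇒≡0 (coord<m e₃ v) k≈0
            displacement = returnMap-coord 2F lvl (cong (dir 2F 0) k≡0) (cong (dir 2F 1) k≡0)
    no-carry : ∀ {v} → Level₀ v → ¬ coord e₃ v ≈ 0 →
               coord e₃ (returnMap 2F v) ≈ suc n + coord e₃ v × coord e₁ (returnMap 2F v) ≈ 2 + coord e₁ v
    no-carry {v} lvl k≉0 = displacement e₃ , displacement e₁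
      where k≡suc = ≉0⇒≡suc k≉0
            displacement = returnMap-coord 2F lvl (cong (dir 2F 0) k≡suc) (cong (dir 2F 1) k≡suc)

  f₂-isHamiltonCycle : (∃ λ h → n ≡ h * 2) → IsHamiltonCycle (f m 2F)
  f₂-isHamiltonCycle (h , n≡2h) =
    isHamiltonCycle-fromOdometer 2F odometer₂ ε-unit turn-unit (λ p q γ≈ α≈ → level₀-ext p q α≈ γ≈)
    where
    ε-unit : IsUnit (suc n)
    ε-unit = isUnit-byMultiple (suc n) (suc (suc h)) (suc h)
      (subst (λ n → suc n * suc (suc h) + 1 ≡ suc h * suc (suc (suc n))) (sym n≡2h) (lemma h))
      where lemma : ∀ h → suc (h * 2) * suc (suc h) + 1 ≡ suc h * suc (suc (suc (h * 2)))
            lemma = solve-∀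
    turn-unit : IsUnit (0 + suc (suc n) * 2)
    turn-unit = isUnit-byMultiple (0 + suc (suc n) * 2) (suc (suc h)) (suc (suc (suc n)))
      (subst (λ n → (0 + suc (suc n) * 2) * suc (suc h) + 1 ≡ suc (suc (suc n)) * suc (suc (suc n))) (sym n≡2h)
             (lemma h))
      where lemma : ∀ h → (0 + suc (suc (h * 2)) * 2) * suc (suc h) + 1
                          ≡ suc (suc (suc (h * 2))) * suc (suc (suc (h * 2)))
            lemma = solve-∀

3+n-odd⇒n-even : ∀ n → suc (suc (suc n)) % 2 ≡ 1 → ∃ λ h → n ≡ h * 2
3+n-odd⇒n-even n odd with (3 + n) / 2 | trans (m≡m%n+[m/n]*n (3 + n) 2) (cong (_+ ((3 + n) / 2) * 2) odd)
... | suc h | 3+n≡3+2h = h , suc-injective (suc-injective (suc-injective 3+n≡3+2h))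

theorem3p5 : (m : ℕ) .{{_ : NonZero m}} → 3 ≤ m → m % 2 ≡ 1 →
    ((c : Fin 3) → IsHamiltonCycle (f m c)) × IsArcDecomposition m (f m)
theorem3p5 (suc (suc (suc n))) (s≤s (s≤s (s≤s _))) odd = hamiltonian , isArcDecomposition (s≤s (s≤s z≤n))
  where
  open ReturnMap n
  open Torus (suc (suc n)) using (isArcDecomposition)
  hamiltonian : (c : Fin 3) → IsHamiltonCycle (f (suc (suc (suc n))) c)
  hamiltonian 0F = f₀-isHamiltonCycle
  hamiltonian 1F = f₁-isHamiltonCycle
  hamiltonian 2F = f₂-isHamiltonCycle (3+n-odd⇒n-even n odd)
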